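{- $\forall\text{ - }\mathcal{BD}<\mathcal{RBD}$: every $\forall\text{ - }\mathcal{BD}$-sentence is equivalent to some $\mathcal{RBD}$-sentence, but some $\mathcal{RBD}$-sentence is not equivalent to any $\forall\text{ - }\mathcal{BD}$-sentence.
   Context: Boolean dependence logic $\mathcal{BD}(\tau)$ ($\tau$ relational) over first-order variables $x,y,\dots$ and Boolean variables $\alpha,\beta,\dots$: $\varphi::=x_1=x_2\mid\neg x_1=x_2\mid\alpha\mid\neg\alpha\mid=(x_1,\dots,x_n,\alpha)\mid R(\vec x)\mid\neg R(\vec x)\mid(\varphi\vee\varphi)\mid(\varphi\wedge\varphi)\mid\forall x\varphi\mid\exists x\varphi\mid\exists\alpha\varphi$. Team semantics: assignments map first-order variables into $A$, Boolean ones into $\{\perp,\top\}$; teams are sets of assignments with common domain. $\mathfrak A\models_X$: first-order literal iff all $s\in X$ satisfy it; $\alpha$/$\neg\alpha$ iff $s(\alpha)=\top$/$\perp$ for all $s\in X$; $=(x_1,\dots,x_n,\alpha)$ iff $s,t\in X$ agreeing on $x_1,\dots,x_n$ have $s(\alpha)=t(\alpha)$; $\wedge$ iff both; $\vee$ iff $X=Y\cup Z$ with the disjuncts holding in $Y$, $Z$; $\exists x\psi$ iff $\psi$ holds in $\{s(F(s)/x):s\in X\}$ for some $F:X\to A$; $\exists\alpha\psi$ likewise with $F:X\to\{\perp,\top\}$; $\forall x\psi$ iff $\psi$ holds in $\{s(a/x):s\in X,a\in A\}$. A sentence is true in $\mathfrak A$ iff it holds in $\{\emptyset\}$. $\mathcal{RBD}$: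 formulas with no dependence atom in the scope of an existential first-order quantifier. $\forall\text{ - }\mathcal{BD}$: formulas without existential first-order quantifiers. $L\le L'$ means each $L$-sentence is equivalent (same models) to some $L'$-sentence; $L<L'$ means $L\le L'$ and not $L'\le L$. -}

module Defs where

open import Level using (Level; 0ℓ) renaming (suc to lsuc)
open import Data.Nat using (ℕ; zero; suc)
open import Data.Fin using (Fin)
open import Data.Vec using (Vec; []; _∷_; lookup; head; tail)
open import Data.List using (List)
open import Data.List.Relation.Unary.All using (All)
open import Data.Bool using (Bool; true; false)
open import Data.Product using (Σ; _×_; _,_; proj₁; proj₂)
open import Data.Sum using (_⊎_)
open import Data.Unit using (⊤)
open import Data.Empty using (⊥)
open import Relation.Nullary using (¬_)
open import Relation.Binary.PropositionalEquality using (_≡_)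

record Vocabulary : Set₁ where
  field
    Sym   : Set
    arity : Sym → ℕ
open Vocabulary public

-- A τ-structure (nonempty domain, witnessed by `elem`).
record Structure (τ : Vocabulary) : Set₁ where
  field
    Carrier : Set
    elem    : Carrier
    relᴬ    : (R : Sym τ) → Vec Carrier (arity τ R) → Set
open Structure public

-- Syntax of BD(τ), well-scoped: n first-order variables and
-- m Boolean variables in scope (de Bruijn; the newest variable is index 0).
-- ⊤ (verum) of the paper is `true`, ⊥ (falsum) is `false`.

data Formula (τ : Vocabulary) : ℕ → ℕ → Set where
  eq     : ∀ {n m} → Fin n → Fin n → Formula τ n m
  neq    : ∀ {n m} → Fin n → Fin n → Formula τ n m
  bvar   : ∀ {n m} → Fin m → Formula τ n m
  nbvar  : ∀ {n m} → Fin m → Formula τ n m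
  dep    : ∀ {n m} → List (Fin n) → Fin m → Formula τ n m
  rel    : ∀ {n m} (R : Sym τ) → Vec (Fin n) (arity τ R) → Formula τ n m
  nrel   : ∀ {n m} (R : Sym τ) → Vec (Fin n) (arity τ R) → Formula τ n m
  _∨'_   : ∀ {n m} → Formula τ n m → Formula τ n m → Formula τ n m
  _∧'_   : ∀ {n m} → Formula τ n m → Formula τ n m → Formula τ n m
  all    : ∀ {n m} → Formula τ (suc n) m → Formula τ n m
  ex     : ∀ {n m} → Formula τ (suc n) m → Formula τ n m
  exB    : ∀ {n m} → Formula τ n (suc m) → Formula τ n m

Sentence : Vocabulary → Set
Sentence τ = Formula τ 0 0

Assignment : Set → ℕ → ℕ → Set
Assignment A n m = Vec A n × Vec Bool m

Team : Set → ℕ → ℕ → Set₁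
Team A n m = Assignment A n m → Set

module _ {τ : Vocabulary} (𝔄 : Structure τ) where
  private A = Carrier 𝔄

  fo : ∀ {n m} → Assignment A n m → Vec A n
  fo = proj₁

  bo : ∀ {n m} → Assignment A n m → Vec Bool m
  bo = proj₂

  valVec : ∀ {n m k} → Assignment A n m → Vec (Fin n) k → Vec A k
  valVec s []       = []
  valVec s (x ∷ xs) = lookup (fo s) x ∷ valVec s xs

  _⊨[_] : ∀ {n m} → Team A n m → Formula τ n m → Set₁
  X ⊨[ eq x y ]     = ∀ s → X s → Level.Lift (lsuc 0ℓ) (lookup (fo s) x ≡ lookup (fo s) y)
  X ⊨[ neq x y ]    = ∀ s → X s → Level.Lift (lsuc 0ℓ) (¬ (lookup (fo s) x ≡ lookup (fo s) y))
  X ⊨[ bvar α ]     = ∀ s → X s → Level.Lift (lsuc 0ℓ) (lookup (bo s) α ≡ true)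
  X ⊨[ nbvar α ]    = ∀ s → X s → Level.Lift (lsuc 0ℓ) (lookup (bo s) α ≡ false)
  X ⊨[ dep xs α ]   = ∀ s t → X s → X t →
                       All (λ x → lookup (fo s) x ≡ lookup (fo t) x) xs →
                       Level.Lift (lsuc 0ℓ) (lookup (bo s) α ≡ lookup (bo t) α)
  X ⊨[ rel R xs ]   = ∀ s → X s → Level.Lift (lsuc 0ℓ) (relᴬ 𝔄 R (valVec s xs))
  X ⊨[ nrel R xs ]  = ∀ s → X s → Level.Lift (lsuc 0ℓ) (¬ relᴬ 𝔄 R (valVec s xs))
  X ⊨[ φ ∨' ψ ]     = Σ (Team A _ _) λ Y → Σ (Team A _ _) λ Z →
                        ((∀ s → X s → Y s ⊎ Z s) × (∀ s → Y s → X s) × (∀ s → Z s → X s))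
                        × (Y ⊨[ φ ]) × (Z ⊨[ ψ ])
  X ⊨[ φ ∧' ψ ]     = (X ⊨[ φ ]) × (X ⊨[ ψ ])
  -- X[A/x] = { s(a/x) : s ∈ X, a ∈ A }
  X ⊨[ all φ ]      = (λ t → X (tail (fo t) , bo t)) ⊨[ φ ]
  -- X[F/x] = { s(F(s)/x) : s ∈ X }
  X ⊨[ ex φ ]       = Σ (Assignment A _ _ → A) λ F →
                        (λ t → X (tail (fo t) , bo t) × (head (fo t) ≡ F (tail (fo t) , bo t))) ⊨[ φ ]
  X ⊨[ exB φ ]      = Σ (Assignment A _ _ → Bool) λ F →
                        (λ t → X (fo t , tail (bo t)) × (head (bo t) ≡ F (fo t , tail (bo t)))) ⊨[ φ ]

  -- the team {∅} consisting of the empty assignment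
  emptyTeam : Team A 0 0
  emptyTeam s = s ≡ ([] , [])

  _⊨_ : Sentence τ → Set₁
  _⊨_ φ = emptyTeam ⊨[ φ ]

Equivalent : ∀ {τ} → Sentence τ → Sentence τ → Set₁
Equivalent {τ} φ ψ = (𝔄 : Structure τ) → ((𝔄 ⊨ φ) → (𝔄 ⊨ ψ)) × ((𝔄 ⊨ ψ) → (𝔄 ⊨ φ))

NoDep : ∀ {τ n m} → Formula τ n m → Set
NoDep (dep _ _) = ⊥
NoDep (φ ∨' ψ)  = NoDep φ × NoDep ψ
NoDep (φ ∧' ψ)  = NoDep φ × NoDep ψ
NoDep (all φ)   = NoDep φ
NoDep (ex φ)    = NoDep φ
NoDep (exB φ)   = NoDep φ
NoDep _         = ⊤

IsRBD : ∀ {τ n m} → Formula τ n m → Set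
IsRBD (φ ∨' ψ) = IsRBD φ × IsRBD ψ
IsRBD (φ ∧' ψ) = IsRBD φ × IsRBD ψ
IsRBD (all φ)  = IsRBD φ
IsRBD (ex φ)   = NoDep φ
IsRBD (exB φ)  = IsRBD φ
IsRBD _        = ⊤

IsForallBD : ∀ {τ n m} → Formula τ n m → Set
IsForallBD (φ ∨' ψ) = IsForallBD φ × IsForallBD ψ
IsForallBD (φ ∧' ψ) = IsForallBD φ × IsForallBD ψ
IsForallBD (all φ)  = IsForallBD φ
IsForallBD (ex φ)   = ⊥
IsForallBD (exB φ)  = IsForallBD φ
IsForallBD _        = ⊤

{-# OPTIONS --safe #-}
-- ∀-BD ⊆ RBD holds syntactically. For strictness, ∀-BD sentences are preserved
-- under substructures, as universal first-order sentences are: if a team Y over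
-- the substructure maps into a team X over the big structure, every ∀-BD formula
-- true in X is true in Y, since ∨ splits and Boolean choice functions compose
-- with the embedding, and there is no ∃x whose witness could lie outside the
-- substructure.
-- The RBD sentence ∃x∃y x ≠ y holds in a two-element set but fails in its
-- one-element substructure.
module Submission where

open import Defs
open import Data.Product using (Σ; _×_; _,_; proj₁; proj₂)
open import Relation.Nullary using (¬_)

open import Level using (lift; lower)
open import Data.Fin using (Fin; #_)
open import Data.Vec using (Vec; []; _∷_; lookup; map)
open import Data.Vec.Properties using (lookup-map)
open import Data.Bool using (Bool; true; false)
open import Data.Sum using (_⊎_; inj₁; inj₂)
open import Data.Unit using (⊤; tt)
open import Data.Empty using (⊥)
import Data.List.Relation.Unary.All as All
open import Function using (id; _∘_)
open import Function.Definitions using (Injective)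
open import Relation.Binary.PropositionalEquality
  using (_≡_; _≢_; refl; sym; trans; cong; cong₂; subst)
open Relation.Binary.PropositionalEquality.≡-Reasoning

forallBD⇒RBD : ∀ {τ n m} (φ : Formula τ n m) → IsForallBD φ → IsRBD φ
forallBD⇒RBD (eq _ _)    _       = tt
forallBD⇒RBD (neq _ _)   _       = tt
forallBD⇒RBD (bvar _)    _       = tt
forallBD⇒RBD (nbvar _)   _       = tt
forallBD⇒RBD (dep _ _)   _       = tt
forallBD⇒RBD (rel _ _)   _       = tt
forallBD⇒RBD (nrel _ _)  _       = tt
forallBD⇒RBD (φ ∨' ψ)    (p , q) = forallBD⇒RBD φ p , forallBD⇒RBD ψ q
forallBD⇒RBD (φ ∧' ψ)    (p , q) = forallBD⇒RBD φ p , forallBD⇒RBD ψ q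
forallBD⇒RBD (all φ)     p       = forallBD⇒RBD φ p
forallBD⇒RBD (exB φ)     p       = forallBD⇒RBD φ p

Equivalent-refl : ∀ {τ} (φ : Sentence τ) → Equivalent φ φ
Equivalent-refl φ 𝔐 = id , id

record Embedding {τ : Vocabulary} (𝔅 𝔄 : Structure τ) : Set where
  field
    to           : Carrier 𝔅 → Carrier 𝔄
    injective    : Injective _≡_ _≡_ to
    rel-preserve : ∀ R v → relᴬ 𝔅 R v → relᴬ 𝔄 R (map to v)
    rel-reflect  : ∀ R v → relᴬ 𝔄 R (map to v) → relᴬ 𝔅 R v

module Preservation {τ : Vocabulary} {𝔅 𝔄 : Structure τ} (e : Embedding 𝔅 𝔄) where
  open Embedding e

  private
    A B : Set
    A = Carrier 𝔄
    B = Carrier 𝔅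

    _⊨ᴬ[_] : ∀ {n m} → Team A n m → Formula τ n m → Set₁
    _⊨ᴬ[_] = _⊨[_] 𝔄

    _⊨ᴮ[_] : ∀ {n m} → Team B n m → Formula τ n m → Set₁
    _⊨ᴮ[_] = _⊨[_] 𝔅

  mapAssignment : ∀ {n m} → Assignment B n m → Assignment A n m
  mapAssignment (v , b) = map to v , b

  _⊆ᵉ_ : ∀ {n m} → Team B n m → Team A n m → Set
  Y ⊆ᵉ X = ∀ s → Y s → X (mapAssignment s)

  valVec-map : ∀ {n m k} (s : Assignment B n m) (xs : Vec (Fin n) k) →
               valVec 𝔄 (mapAssignment s) xs ≡ map to (valVec 𝔅 s xs)
  valVec-map s []       = refl
  valVec-map s (x ∷ xs) = cong₂ _∷_ (lookup-map x to (proj₁ s)) (valVec-map s xs)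

  lookup-map-≡ : ∀ {n k} {v : Vec B n} {w : Vec B k} {x y} →
                 lookup v x ≡ lookup w y → lookup (map to v) x ≡ lookup (map to w) y
  lookup-map-≡ {v = v} {w} {x} {y} v[x]≡w[y] = begin
    lookup (map to v) x  ≡⟨ lookup-map x to v ⟩
    to (lookup v x)      ≡⟨ cong to v[x]≡w[y] ⟩
    to (lookup w y)      ≡⟨ lookup-map y to w ⟨
    lookup (map to w) y  ∎

  lookup-map-≡⁻¹ : ∀ {n k} {v : Vec B n} {w : Vec B k} {x y} →
                   lookup (map to v) x ≡ lookup (map to w) y → lookup v x ≡ lookup w y
  lookup-map-≡⁻¹ {v = v} {w} {x} {y} to[v[x]]≡to[w[y]] =
    injective (trans (sym (lookup-map x to v)) (trans to[v[x]]≡to[w[y]] (lookup-map y to w)))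

  forallBD-preserved : ∀ {n m} (φ : Formula τ n m) → IsForallBD φ →
                       (X : Team A n m) (Y : Team B n m) → Y ⊆ᵉ X →
                       X ⊨ᴬ[ φ ] → Y ⊨ᴮ[ φ ]
  forallBD-preserved (eq x y) _ X Y Y⊆X X⊨ s@(v , _) Ys =
    lift (lookup-map-≡⁻¹ {v = v} {w = v} (lower (X⊨ _ (Y⊆X s Ys))))
  forallBD-preserved (neq x y) _ X Y Y⊆X X⊨ s@(v , _) Ys =
    lift λ v[x]≡v[y] → lower (X⊨ _ (Y⊆X s Ys)) (lookup-map-≡ {v = v} {w = v} v[x]≡v[y])
  forallBD-preserved (bvar α)  _ X Y Y⊆X X⊨ s Ys = lift (lower (X⊨ _ (Y⊆X s Ys)))
  forallBD-preserved (nbvar α) _ X Y Y⊆X X⊨ s Ys = lift (lower (X⊨ _ (Y⊆X s Ys)))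
  forallBD-preserved (dep xs α) _ X Y Y⊆X X⊨ s@(v , _) t@(w , _) Ys Yt agree =
    lift (lower (X⊨ _ _ (Y⊆X s Ys) (Y⊆X t Yt)
                    (All.map (lookup-map-≡ {v = v} {w}) agree)))
  forallBD-preserved (rel R xs) _ X Y Y⊆X X⊨ s Ys =
    lift (rel-reflect R _
           (subst (relᴬ 𝔄 R) (valVec-map s xs) (lower (X⊨ _ (Y⊆X s Ys)))))
  forallBD-preserved (nrel R xs) _ X Y Y⊆X X⊨ s Ys =
    lift λ Rs → lower (X⊨ _ (Y⊆X s Ys))
      (subst (relᴬ 𝔄 R) (sym (valVec-map s xs)) (rel-preserve R _ Rs))
  forallBD-preserved {n} {m} (φ ∨' ψ) (p , q) X Y Y⊆X
                     (X₁ , X₂ , (X⊆X₁∪X₂ , _ , _) , X₁⊨ , X₂⊨) =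
    Y₁ , Y₂ , (split , (λ _ → proj₁) , (λ _ → proj₁)) ,
    forallBD-preserved φ p X₁ Y₁ (λ _ → proj₂) X₁⊨ ,
    forallBD-preserved ψ q X₂ Y₂ (λ _ → proj₂) X₂⊨
    where
    Y₁ Y₂ : Team B n m
    Y₁ s = Y s × X₁ (mapAssignment s)
    Y₂ s = Y s × X₂ (mapAssignment s)
    split : ∀ s → Y s → Y₁ s ⊎ Y₂ s
    split s Ys with X⊆X₁∪X₂ _ (Y⊆X s Ys)
    ... | inj₁ X₁s = inj₁ (Ys , X₁s)
    ... | inj₂ X₂s = inj₂ (Ys , X₂s)
  forallBD-preserved (φ ∧' ψ) (p , q) X Y Y⊆X (X⊨φ , X⊨ψ) =
    forallBD-preserved φ p X Y Y⊆X X⊨φ , forallBD-preserved ψ q X Y Y⊆X X⊨ψ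
  forallBD-preserved (all φ) p X Y Y⊆X X⊨ =
    forallBD-preserved φ p _ _ (λ { (_ ∷ v , b) → Y⊆X (v , b) }) X⊨
  forallBD-preserved (exB φ) p X Y Y⊆X (F , X⊨) =
    F ∘ mapAssignment ,
    forallBD-preserved φ p _ _ (λ { (v , _ ∷ b) (Ys , F≡) → Y⊆X (v , b) Ys , F≡ }) X⊨

  forallBD-sentence-preserved : (φ : Sentence τ) → IsForallBD φ → 𝔄 ⊨ φ → 𝔅 ⊨ φ
  forallBD-sentence-preserved φ p =
    forallBD-preserved φ p (emptyTeam 𝔄) (emptyTeam 𝔅) λ { _ refl → refl }

open Preservation using (forallBD-sentence-preserved)

module _ {τ : Vocabulary} where

  pureSet : (A : Set) → A → Structure τ
  pureSet A a = record { Carrier = A ; elem = a ; relᴬ = λ _ _ → ⊥ }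

  pureSet-embedding : ∀ {A B : Set} {a b} (f : B → A) → Injective _≡_ _≡_ f →
                      Embedding (pureSet B b) (pureSet A a)
  pureSet-embedding f f-inj = record
    { to = f ; injective = f-inj ; rel-preserve = λ _ _ → id ; rel-reflect = λ _ _ → id }

  distinctPair : Sentence τ
  distinctPair = ex (ex (neq (# 0) (# 1)))

  distinctPair-holds : (𝔐 : Structure τ) (a b : Carrier 𝔐) → a ≢ b → 𝔐 ⊨ distinctPair
  distinctPair-holds 𝔐 a b a≢b = (λ _ → a) , (λ _ → b) , λ where
    (y ∷ x ∷ [] , []) ((_ , x≡a) , y≡b) →
      lift λ y≡x → a≢b (trans (sym x≡a) (trans (sym y≡x) y≡b))

  distinctPair-fails : (𝔐 : Structure τ) → ((a b : Carrier 𝔐) → a ≡ b) → ¬ (𝔐 ⊨ distinctPair)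
  distinctPair-fails 𝔐 trivial (F , G , distinct) =
    lower (distinct (b ∷ a ∷ [] , []) ((refl , refl) , refl)) (trivial b a)
    where
    a b : Carrier 𝔐
    a = F ([] , [])
    b = G (a ∷ [] , [])

corollary7p3 : (τ : Vocabulary) →
    ((φ : Sentence τ) → IsForallBD φ → Σ (Sentence τ) λ ψ → IsRBD ψ × Equivalent φ ψ)
    × (Σ (Sentence τ) λ φ → IsRBD φ × ((ψ : Sentence τ) → IsForallBD ψ → ¬ Equivalent φ ψ))
corollary7p3 τ =
  (λ φ p → φ , forallBD⇒RBD φ p , Equivalent-refl φ) ,
  (distinctPair , tt , not-forallBD)
  where
  two one : Structure τ
  two = pureSet Bool true
  one = pureSet ⊤ tt

  one↪two : Embedding one two
  one↪two = pureSet-embedding (λ _ → true) (λ _ → refl)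

  not-forallBD : (ψ : Sentence τ) → IsForallBD ψ → ¬ Equivalent distinctPair ψ
  not-forallBD ψ p ≡ψ =
    distinctPair-fails one (λ _ _ → refl)
      (proj₂ (≡ψ one) (forallBD-sentence-preserved one↪two ψ p
        (proj₁ (≡ψ two) (distinctPair-holds two true false λ ()))))
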